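{- Let $\ell \geq 1$ and $n, s, k \geq 0$ be integers with $n \geq s$ and $n \geq k$. Define \[ F(n,k)= (-1)^{k}(2\ell n +1) \frac{\left(\frac{1}{\ell}\right)_{n+s}\left(\frac{1}{\ell}\right)_{n-s}\left(\frac{1}{\ell}\right)_{n}\left(\frac{1}{\ell}\right)_{n+k}}{(1)_{n+s}(1)_{n-s}(1)_{n}(1)_{n-k}\left(\frac{1}{\ell}\right)_{k+s}\left(\frac{1}{\ell}\right)_{k-s}} \] and \[ G(n,k)= (-1)^{k-1} \ell^2\, \frac{\left(\frac{1}{\ell}\right)_{n+s}\left(\frac{1}{\ell}\right)_{n-s}\left(\frac{1}{\ell}\right)_{n}\left(\frac{1}{\ell}\right)_{n+k-1}}{(1)_{n+s-1}(1)_{n-s-1}(1)_{n-1}(1)_{n-k}\left(\frac{1}{\ell}\right)_{k+s}\left(\frac{1}{\ell}\right)_{k-s}}, \] with the convention $1/(1)_{m}=0$ for $m=-1,-2,\ldots$. Then \[ (\ell k - \ell + 1)F(n,k-1) - (\ell k -\ell + 2)F(n,k)= G(n+1,k) - G(n,k). \]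
   Context: Rising factorial: $(a)_0=1$, $(a)_n=a(a+1)\cdots(a+n-1)$ for $n\geq 1$, and for negative index $(a)_{ -n}=\frac{1}{(a-1)(a-2)\cdots(a-n)}=\frac{1}{(a-n)_n}=\frac{(-1)^n}{(1-a)_n}$ for $n\ge 1$. -}

module Defs where

open import Data.Nat as ℕ using (ℕ; zero; suc)
open import Data.Integer as ℤ using (ℤ; +_; -[1+_])
open import Data.Rational using (ℚ; 0ℚ; 1ℚ; _+_; _-_; _*_; -_; 1/_; _/_; ≢-nonZero)
open import Data.Rational.Properties using (_≟_)
open import Relation.Nullary using (yes; no)

ℤ→ℚ : ℤ → ℚ
ℤ→ℚ i = i / 1

ℕ→ℚ : ℕ → ℚ
ℕ→ℚ n = (+ n) / 1

-- total reciprocal: inv 0 = 0, inv q = 1/q otherwise.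
-- This implements the paper's convention 1/(1)_m = 0 for negative m.
inv : ℚ → ℚ
inv q with q ≟ 0ℚ
... | yes _ = 0ℚ
... | no q≢0 = 1/_ q {{≢-nonZero q≢0}}

rising : ℚ → ℕ → ℚ
rising a zero = 1ℚ
rising a (suc n) = rising a n * (a + ℕ→ℚ n)

poch : ℚ → ℤ → ℚ
poch a (+ n) = rising a n
poch a -[1+ n ] = inv (rising (a - ℕ→ℚ (suc n)) (suc n))

negOnePowℕ : ℕ → ℚ
negOnePowℕ zero = 1ℚ
negOnePowℕ (suc n) = - negOnePowℕ n

negOnePow : ℤ → ℚ
negOnePow m = negOnePowℕ ℤ.∣ m ∣

F : (ℓ s : ℕ) → ℤ → ℤ → ℚ
F ℓ s n k =
  let a = inv (ℕ→ℚ ℓ)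
      S = + s
  in negOnePow k
     * ((ℤ→ℚ (+ 2 ℤ.* + ℓ ℤ.* n ℤ.+ + 1))
     * (poch a (n ℤ.+ S) * poch a (n ℤ.- S) * poch a n * poch a (n ℤ.+ k)
     * (inv (poch 1ℚ (n ℤ.+ S)) * inv (poch 1ℚ (n ℤ.- S)) * inv (poch 1ℚ n)
        * inv (poch 1ℚ (n ℤ.- k))
        * inv (poch a (k ℤ.+ S)) * inv (poch a (k ℤ.- S)))))

G : (ℓ s : ℕ) → ℤ → ℤ → ℚ
G ℓ s n k =
  let a = inv (ℕ→ℚ ℓ)
      S = + s
  in negOnePow (k ℤ.- + 1)
     * (ℕ→ℚ (ℓ ℕ.* ℓ)
     * (poch a (n ℤ.+ S) * poch a (n ℤ.- S) * poch a n * poch a (n ℤ.+ k ℤ.- + 1)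
     * (inv (poch 1ℚ (n ℤ.+ S ℤ.- + 1)) * inv (poch 1ℚ (n ℤ.- S ℤ.- + 1))
        * inv (poch 1ℚ (n ℤ.- + 1)) * inv (poch 1ℚ (n ℤ.- k))
        * inv (poch a (k ℤ.+ S)) * inv (poch a (k ℤ.- S)))))

module Submission where

-- With a = 1/ℓ, for n ≥ 1 the four terms F(n,k-1), F(n,k), G(n+1,k), G(n,k) are all
-- multiples of one product
--   W = (-1)^(k-1) (a)_{n+s} (a)_{n-s} (a)_n (a)_{n+k-1}
--         / ((1)_{n+s} (1)_{n-s} (1)_n (1)_{n-k+1} (a)_{k+s} (a)_{k-s}) :
-- rising factorials are moved up by (b)_{j+1} = (b)_j (b + j) for j ≥ 0, and reciprocals
-- are moved down by 1/(b)_{j-1} = (b + j - 1)/(b)_j, which holds at every integer j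
-- (b not a non-positive integer), so the convention 1/(1)_m = 0 for m < 0 needs no
-- separate treatment. After dividing by W the recurrence is a polynomial identity in
-- a, ℓ, n, k, s. For n = 0 (so s = k = 0) the four terms are evaluated directly.

open import Defs
open import Data.Empty using (⊥-elim)
open import Data.Nat as ℕ using (ℕ; zero; suc; _≤_; _∸_; z≤n; s≤s)
import Data.Nat.Properties as ℕP
import Data.Nat.Coprimality as Coprimality
open import Data.Integer as ℤ using (ℤ; +_; -[1+_])
import Data.Integer.Properties as ℤP
import Data.Integer.Solver as ℤSolver
open import Data.Rational using (ℚ; 0ℚ; 1ℚ; _+_; _-_; _*_; -_; mkℚ; ↥_; ≢-nonZero)
open import Data.Rational.Properties using (_≟_; ↥p/↧p≡p; *-inverseʳ; *-comm; *-identityˡ; *-identityʳ; *-zeroˡ; *-zeroʳ)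
open import Data.Rational.Solver using (module +-*-Solver)
open import Relation.Binary.PropositionalEquality
open import Relation.Nullary using (Dec; yes; no)

open +-*-Solver using (solve; _:+_; _:*_; :-_; _:-_; _:=_; con)
open ℤSolver.+-*-Solver using ()
  renaming (solve to ℤ-solve; _:+_ to infixl 7 _⊕_; _:-_ to infixl 7 _⊝_; _:=_ to infix 4 _≐_; con to ℤ-con)

private
  -- i / 1 without normalisation; ℚ's + and * on these compute to _/_ of the integer results.
  mkℚ/1 : ℤ → ℚ
  mkℚ/1 i = mkℚ i 0 (Coprimality.sym (Coprimality.1-coprimeTo ℤ.∣ i ∣))

  ℤ→ℚ≡mkℚ/1 : ∀ i → ℤ→ℚ i ≡ mkℚ/1 i
  ℤ→ℚ≡mkℚ/1 i = ↥p/↧p≡p (mkℚ/1 i)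

ℤ→ℚ-homo-+ : ∀ i j → ℤ→ℚ (i ℤ.+ j) ≡ ℤ→ℚ i + ℤ→ℚ j
ℤ→ℚ-homo-+ i j = begin
  ℤ→ℚ (i ℤ.+ j)
    ≡⟨ cong₂ (λ x y → ℤ→ℚ (x ℤ.+ y)) (sym (ℤP.*-identityʳ i)) (sym (ℤP.*-identityʳ j)) ⟩
  mkℚ/1 i + mkℚ/1 j
    ≡⟨ cong₂ _+_ (sym (ℤ→ℚ≡mkℚ/1 i)) (sym (ℤ→ℚ≡mkℚ/1 j)) ⟩
  ℤ→ℚ i + ℤ→ℚ j ∎
  where open ≡-Reasoning

ℤ→ℚ-homo-* : ∀ i j → ℤ→ℚ (i ℤ.* j) ≡ ℤ→ℚ i * ℤ→ℚ j
ℤ→ℚ-homo-* i j = cong₂ _*_ (sym (ℤ→ℚ≡mkℚ/1 i)) (sym (ℤ→ℚ≡mkℚ/1 j))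

ℤ→ℚ-homo-neg : ∀ i → ℤ→ℚ (ℤ.- i) ≡ - ℤ→ℚ i
ℤ→ℚ-homo-neg i = begin
  ℤ→ℚ (ℤ.- i)   ≡⟨ ℤ→ℚ≡mkℚ/1 (ℤ.- i) ⟩
  mkℚ/1 (ℤ.- i) ≡⟨ mkℚ-neg i ⟩
  - mkℚ/1 i     ≡⟨ cong -_ (sym (ℤ→ℚ≡mkℚ/1 i)) ⟩
  - ℤ→ℚ i       ∎
  where
  open ≡-Reasoning
  mkℚ-neg : ∀ i → mkℚ/1 (ℤ.- i) ≡ - mkℚ/1 i
  mkℚ-neg (+ zero)  = refl
  mkℚ-neg (+ suc n) = refl
  mkℚ-neg -[1+ n ]  = refl

ℤ→ℚ-homo-sub : ∀ i j → ℤ→ℚ (i ℤ.- j) ≡ ℤ→ℚ i - ℤ→ℚ j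
ℤ→ℚ-homo-sub i j = trans (ℤ→ℚ-homo-+ i (ℤ.- j)) (cong (λ x → ℤ→ℚ i + x) (ℤ→ℚ-homo-neg j))

ℕ→ℚ-homo-+ : ∀ m n → ℕ→ℚ (m ℕ.+ n) ≡ ℕ→ℚ m + ℕ→ℚ n
ℕ→ℚ-homo-+ m n = ℤ→ℚ-homo-+ (+ m) (+ n)

ℕ→ℚ-homo-* : ∀ m n → ℕ→ℚ (m ℕ.* n) ≡ ℕ→ℚ m * ℕ→ℚ n
ℕ→ℚ-homo-* m n = trans (cong ℤ→ℚ (ℤP.pos-* m n)) (ℤ→ℚ-homo-* (+ m) (+ n))

ℕ→ℚ-suc : ∀ m → ℕ→ℚ (suc m) ≡ 1ℚ + ℕ→ℚ m
ℕ→ℚ-suc = ℕ→ℚ-homo-+ 1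

ℕ→ℚ-suc≢0 : ∀ m → ℕ→ℚ (suc m) ≢ 0ℚ
ℕ→ℚ-suc≢0 m eq with cong ↥_ (trans (sym (ℤ→ℚ≡mkℚ/1 (+ suc m))) eq)
... | ()

[+m]-[+n]≡+[m∸n] : ∀ {m n} → n ≤ m → + m ℤ.- + n ≡ + (m ∸ n)
[+m]-[+n]≡+[m∸n] {m} {n} n≤m = trans (ℤP.[+m]-[+n]≡m⊖n m n) (ℤP.⊖-≥ n≤m)

1ℚ≢0ℚ : 1ℚ ≢ 0ℚ
1ℚ≢0ℚ ()

inv-inverseʳ : ∀ x → x ≢ 0ℚ → x * inv x ≡ 1ℚ
inv-inverseʳ x x≢0 with x ≟ 0ℚ
... | yes x≡0 = ⊥-elim (x≢0 x≡0)
... | no x≢0′ = *-inverseʳ x {{≢-nonZero x≢0′}}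

inv-unique : ∀ x y → x * y ≡ 1ℚ → inv x ≡ y
inv-unique x y xy≡1 = begin
  inv x             ≡⟨ solve 1 (λ u → u := u :* con 1ℚ) refl (inv x) ⟩
  inv x * 1ℚ        ≡⟨ cong (inv x *_) (sym xy≡1) ⟩
  inv x * (x * y)   ≡⟨ solve 3 (λ u x y → u :* (x :* y) := (x :* u) :* y) refl (inv x) x y ⟩
  (x * inv x) * y   ≡⟨ cong (_* y) (inv-inverseʳ x x≢0) ⟩
  1ℚ * y            ≡⟨ *-identityˡ y ⟩
  y                 ∎
  where
  open ≡-Reasoning
  x≢0 : x ≢ 0ℚ
  x≢0 x≡0 = 1ℚ≢0ℚ (trans (sym xy≡1) (trans (cong (_* y) x≡0) (*-zeroˡ y)))

inv-involutive : ∀ x → inv (inv x) ≡ x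
inv-involutive x = by-cases (x ≟ 0ℚ)
  where
  by-cases : Dec (x ≡ 0ℚ) → inv (inv x) ≡ x
  by-cases (yes x≡0) = subst (λ z → inv (inv z) ≡ z) (sym x≡0) refl
  by-cases (no x≢0)  = inv-unique (inv x) x (trans (*-comm (inv x) x) (inv-inverseʳ x x≢0))

inv-distrib-* : ∀ x y → inv (x * y) ≡ inv x * inv y
inv-distrib-* x y = by-cases (x ≟ 0ℚ) (y ≟ 0ℚ)
  where
  open ≡-Reasoning
  by-cases : Dec (x ≡ 0ℚ) → Dec (y ≡ 0ℚ) → inv (x * y) ≡ inv x * inv y
  by-cases (yes x≡0) _ =
    subst (λ z → inv (z * y) ≡ inv z * inv y) (sym x≡0) (trans (cong inv (*-zeroˡ y)) (sym (*-zeroˡ (inv y))))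
  by-cases (no _) (yes y≡0) =
    subst (λ z → inv (x * z) ≡ inv x * inv z) (sym y≡0) (trans (cong inv (*-zeroʳ x)) (sym (*-zeroʳ (inv x))))
  by-cases (no x≢0) (no y≢0) = inv-unique (x * y) (inv x * inv y) (begin
    (x * y) * (inv x * inv y)
      ≡⟨ solve 4 (λ x y u v → (x :* y) :* (u :* v) := (x :* u) :* (y :* v)) refl x y (inv x) (inv y) ⟩
    (x * inv x) * (y * inv y)
      ≡⟨ cong₂ _*_ (inv-inverseʳ x x≢0) (inv-inverseʳ y y≢0) ⟩
    1ℚ ∎)

inv[x]*x*x≡x : ∀ x → inv x * x * x ≡ x
inv[x]*x*x≡x x = by-cases (x ≟ 0ℚ)
  where
  by-cases : Dec (x ≡ 0ℚ) → inv x * x * x ≡ x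
  by-cases (yes x≡0) = subst (λ z → inv z * z * z ≡ z) (sym x≡0) refl
  by-cases (no x≢0)  = trans (cong (_* x) (trans (*-comm (inv x) x) (inv-inverseʳ x x≢0))) (*-identityˡ x)

negOnePow-pred : ∀ i → negOnePow i ≡ - negOnePow (i ℤ.- + 1)
negOnePow-pred (+ zero)  = refl
negOnePow-pred (+ suc n) = refl
negOnePow-pred -[1+ n ] rewrite ℕP.+-identityʳ n =
  solve 1 (λ x → :- x := :- (:- (:- x))) refl (negOnePowℕ n)

rising-suc-unfoldˡ : ∀ b m → rising b (suc m) ≡ b * rising (b + 1ℚ) m
rising-suc-unfoldˡ b zero = solve 1 (λ b → con 1ℚ :* (b :+ con 0ℚ) := b :* con 1ℚ) refl b
rising-suc-unfoldˡ b (suc m) = begin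
  rising b (suc m) * (b + ℕ→ℚ (suc m))
    ≡⟨ cong₂ (λ r x → r * (b + x)) (rising-suc-unfoldˡ b m) (ℕ→ℚ-suc m) ⟩
  b * rising (b + 1ℚ) m * (b + (1ℚ + ℕ→ℚ m))
    ≡⟨ solve 3 (λ b r x → b :* r :* (b :+ (con 1ℚ :+ x)) := b :* (r :* ((b :+ con 1ℚ) :+ x)))
         refl b (rising (b + 1ℚ) m) (ℕ→ℚ m) ⟩
  b * (rising (b + 1ℚ) m * ((b + 1ℚ) + ℕ→ℚ m)) ∎
  where open ≡-Reasoning

poch-suc : ∀ b {j} t → j ≡ + t → poch b (j ℤ.+ + 1) ≡ poch b j * (b + ℤ→ℚ j)
poch-suc b t refl = cong (rising b) (ℕP.+-comm t 1)

inv-poch-pred : ∀ b → (∀ t → b + ℕ→ℚ t ≢ 0ℚ) → ∀ j →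
  inv (poch b (j ℤ.- + 1)) ≡ (b + ℤ→ℚ (j ℤ.- + 1)) * inv (poch b j)
inv-poch-pred b b+t≢0 (+ zero) =
  trans (inv-involutive _)
    (solve 1 (λ b → con 1ℚ :* ((b :- con 1ℚ) :+ con 0ℚ) := (b :+ con (- 1ℚ)) :* con 1ℚ) refl b)
inv-poch-pred b b+t≢0 (+ suc t) = sym (begin
  (b + ℕ→ℚ t) * inv (rising b t * (b + ℕ→ℚ t))
    ≡⟨ cong ((b + ℕ→ℚ t) *_) (inv-distrib-* (rising b t) (b + ℕ→ℚ t)) ⟩
  (b + ℕ→ℚ t) * (inv (rising b t) * inv (b + ℕ→ℚ t))
    ≡⟨ solve 3 (λ x r y → x :* (r :* y) := r :* (x :* y)) refl (b + ℕ→ℚ t) (inv (rising b t)) (inv (b + ℕ→ℚ t)) ⟩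
  inv (rising b t) * ((b + ℕ→ℚ t) * inv (b + ℕ→ℚ t))
    ≡⟨ cong (inv (rising b t) *_) (inv-inverseʳ (b + ℕ→ℚ t) (b+t≢0 t)) ⟩
  inv (rising b t) * 1ℚ
    ≡⟨ *-identityʳ _ ⟩
  inv (rising b t) ∎)
  where open ≡-Reasoning
inv-poch-pred b b+t≢0 -[1+ t ] rewrite ℕP.+-identityʳ t = begin
  inv (inv (rising (b - ℕ→ℚ (suc (suc t))) (suc (suc t))))
    ≡⟨ inv-involutive _ ⟩
  rising (b - ℕ→ℚ (suc (suc t))) (suc (suc t))
    ≡⟨ rising-suc-unfoldˡ _ (suc t) ⟩
  (b - ℕ→ℚ (suc (suc t))) * rising (b - ℕ→ℚ (suc (suc t)) + 1ℚ) (suc t)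
    ≡⟨ cong (λ c → (b - ℕ→ℚ (suc (suc t))) * rising c (suc t)) shift ⟩
  (b - ℕ→ℚ (suc (suc t))) * rising (b - ℕ→ℚ (suc t)) (suc t)
    ≡⟨ cong₂ _*_ (cong (λ x → b + x) (sym (ℤ→ℚ-homo-neg (+ suc (suc t))))) (sym (inv-involutive _)) ⟩
  (b + ℤ→ℚ -[1+ suc t ]) * inv (inv (rising (b - ℕ→ℚ (suc t)) (suc t))) ∎
  where
  open ≡-Reasoning
  shift : b - ℕ→ℚ (suc (suc t)) + 1ℚ ≡ b - ℕ→ℚ (suc t)
  shift = trans (cong (λ x → b - x + 1ℚ) (ℕ→ℚ-suc (suc t)))
    (solve 2 (λ b x → b :- (con 1ℚ :+ x) :+ con 1ℚ := b :- x) refl b (ℕ→ℚ (suc t)))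

inv-factorial-pred : ∀ j → inv (poch 1ℚ (j ℤ.- + 1)) ≡ ℤ→ℚ j * inv (poch 1ℚ j)
inv-factorial-pred j =
  trans (inv-poch-pred 1ℚ 1+t≢0 j)
    (cong (_* inv (poch 1ℚ j))
      (trans (cong (λ x → 1ℚ + x) (ℤ→ℚ-homo-sub j (+ 1)))
        (solve 1 (λ x → con 1ℚ :+ (x :- con 1ℚ) := x) refl (ℤ→ℚ j))))
  where
  1+t≢0 : ∀ t → 1ℚ + ℕ→ℚ t ≢ 0ℚ
  1+t≢0 t eq = ℕ→ℚ-suc≢0 t (trans (ℕ→ℚ-suc t) eq)

-- F and G unfold definitionally to this shape. Agda cannot invert that unfolding, so
-- uses of term-cong name every unchanged factor (refl {x = …}) instead of writing refl.
term : (σ c p₁ p₂ p₃ p₄ r₁ r₂ r₃ r₄ r₅ r₆ : ℚ) → ℚ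
term σ c p₁ p₂ p₃ p₄ r₁ r₂ r₃ r₄ r₅ r₆ = σ * (c * (p₁ * p₂ * p₃ * p₄ * (r₁ * r₂ * r₃ * r₄ * r₅ * r₆)))

term-cong : ∀ {σ c p₁ p₂ p₃ p₄ r₁ r₂ r₃ r₄ r₅ r₆ σ′ c′ p₁′ p₂′ p₃′ p₄′ r₁′ r₂′ r₃′ r₄′ r₅′ r₆′} →
  σ ≡ σ′ → c ≡ c′ → p₁ ≡ p₁′ → p₂ ≡ p₂′ → p₃ ≡ p₃′ → p₄ ≡ p₄′ →
  r₁ ≡ r₁′ → r₂ ≡ r₂′ → r₃ ≡ r₃′ → r₄ ≡ r₄′ → r₅ ≡ r₅′ → r₆ ≡ r₆′ →
  term σ c p₁ p₂ p₃ p₄ r₁ r₂ r₃ r₄ r₅ r₆ ≡ term σ′ c′ p₁′ p₂′ p₃′ p₄′ r₁′ r₂′ r₃′ r₄′ r₅′ r₆′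
term-cong refl refl refl refl refl refl refl refl refl refl refl refl = refl

-- The recurrence divided by the common factor W of the four terms (see WZPair below);
-- it holds identically in L and a.
reduced-recurrence : ∀ L a n k s W →
  L * (k - 1ℚ + a) * (W * (L * (n + n + a) * ((a + (k + s - 1ℚ)) * (a + (k - s - 1ℚ)))))
  - L * (k - 1ℚ + a + a) * (- W * (L * (n + n + a) * ((a + (n + k - 1ℚ)) * (1ℚ + (n - k)))))
  ≡ W * (L * L * ((a + (n + s)) * (a + (n - s)) * (a + n) * (a + (n + k - 1ℚ))))
  - W * (L * L * ((n + s) * (n - s) * n * (1ℚ + (n - k))))
reduced-recurrence = solve 6 (λ L a n k s W →
  L :* (k :- con 1ℚ :+ a) :* (W :* (L :* (n :+ n :+ a) :* ((a :+ (k :+ s :- con 1ℚ)) :* (a :+ (k :- s :- con 1ℚ)))))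
  :- L :* (k :- con 1ℚ :+ a :+ a) :* ((:- W) :* (L :* (n :+ n :+ a) :* ((a :+ (n :+ k :- con 1ℚ)) :* (con 1ℚ :+ (n :- k)))))
  := W :* (L :* L :* ((a :+ (n :+ s)) :* (a :+ (n :- s)) :* (a :+ n) :* (a :+ (n :+ k :- con 1ℚ))))
  :- W :* (L :* L :* ((n :+ s) :* (n :- s) :* n :* (con 1ℚ :+ (n :- k))))) refl

module WZPair (l : ℕ) where

  private
    ℓ : ℕ
    ℓ = suc l

    L a : ℚ
    L = ℕ→ℚ ℓ
    a = inv L

  a*L≡1 : a * L ≡ 1ℚ
  a*L≡1 = trans (*-comm a L) (inv-inverseʳ L (ℕ→ℚ-suc≢0 l))

  a+t≢0 : ∀ t → a + ℕ→ℚ t ≢ 0ℚ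
  a+t≢0 t eq = ℕ→ℚ-suc≢0 (ℓ ℕ.* t) (begin
    ℕ→ℚ (suc (ℓ ℕ.* t))  ≡⟨ trans (ℕ→ℚ-suc (ℓ ℕ.* t)) (cong (λ x → 1ℚ + x) (ℕ→ℚ-homo-* ℓ t)) ⟩
    1ℚ + L * ℕ→ℚ t       ≡⟨ cong (λ x → x + L * ℕ→ℚ t) (sym a*L≡1) ⟩
    a * L + L * ℕ→ℚ t    ≡⟨ solve 3 (λ a L x → a :* L :+ L :* x := L :* (a :+ x)) refl a L (ℕ→ℚ t) ⟩
    L * (a + ℕ→ℚ t)      ≡⟨ cong (L *_) eq ⟩
    L * 0ℚ               ≡⟨ *-zeroʳ L ⟩
    0ℚ                   ∎)
    where open ≡-Reasoning

  private
    ℓk-ℓ≡ : ∀ k → ℤ→ℚ (+ ℓ ℤ.* + k ℤ.- + ℓ) ≡ L * ℕ→ℚ k - L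
    ℓk-ℓ≡ k = trans (ℤ→ℚ-homo-sub (+ ℓ ℤ.* + k) (+ ℓ)) (cong (_- L) (ℤ→ℚ-homo-* (+ ℓ) (+ k)))

  ℓk-ℓ+1≡ℓ[k-1+a] : ∀ k → ℤ→ℚ (+ ℓ ℤ.* + k ℤ.- + ℓ ℤ.+ + 1) ≡ L * (ℕ→ℚ k - 1ℚ + a)
  ℓk-ℓ+1≡ℓ[k-1+a] k = begin
    ℤ→ℚ (+ ℓ ℤ.* + k ℤ.- + ℓ ℤ.+ + 1)  ≡⟨ ℤ→ℚ-homo-+ (+ ℓ ℤ.* + k ℤ.- + ℓ) (+ 1) ⟩
    ℤ→ℚ (+ ℓ ℤ.* + k ℤ.- + ℓ) + 1ℚ     ≡⟨ cong₂ _+_ (ℓk-ℓ≡ k) (sym a*L≡1) ⟩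
    L * ℕ→ℚ k - L + a * L              ≡⟨ solve 3 (λ L k a → L :* k :- L :+ a :* L := L :* (k :- con 1ℚ :+ a)) refl L (ℕ→ℚ k) a ⟩
    L * (ℕ→ℚ k - 1ℚ + a)               ∎
    where open ≡-Reasoning

  ℓk-ℓ+2≡ℓ[k-1+2a] : ∀ k → ℤ→ℚ (+ ℓ ℤ.* + k ℤ.- + ℓ ℤ.+ + 2) ≡ L * (ℕ→ℚ k - 1ℚ + a + a)
  ℓk-ℓ+2≡ℓ[k-1+2a] k = begin
    ℤ→ℚ (+ ℓ ℤ.* + k ℤ.- + ℓ ℤ.+ + 2)      ≡⟨ ℤ→ℚ-homo-+ (+ ℓ ℤ.* + k ℤ.- + ℓ) (+ 2) ⟩
    ℤ→ℚ (+ ℓ ℤ.* + k ℤ.- + ℓ) + (1ℚ + 1ℚ)  ≡⟨ cong₂ (λ x y → x + (y + y)) (ℓk-ℓ≡ k) (sym a*L≡1) ⟩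
    L * ℕ→ℚ k - L + (a * L + a * L)        ≡⟨ solve 3 (λ L k a → L :* k :- L :+ (a :* L :+ a :* L) := L :* (k :- con 1ℚ :+ a :+ a)) refl L (ℕ→ℚ k) a ⟩
    L * (ℕ→ℚ k - 1ℚ + a + a)               ∎
    where open ≡-Reasoning

  2ℓn+1≡ℓ[2n+a] : ∀ n → ℤ→ℚ (+ 2 ℤ.* + ℓ ℤ.* + n ℤ.+ + 1) ≡ L * (ℕ→ℚ n + ℕ→ℚ n + a)
  2ℓn+1≡ℓ[2n+a] n = begin
    ℤ→ℚ (+ 2 ℤ.* + ℓ ℤ.* + n ℤ.+ + 1)  ≡⟨ ℤ→ℚ-homo-+ (+ 2 ℤ.* + ℓ ℤ.* + n) (+ 1) ⟩
    ℤ→ℚ (+ 2 ℤ.* + ℓ ℤ.* + n) + 1ℚ     ≡⟨ cong₂ _+_ (trans (ℤ→ℚ-homo-* (+ 2 ℤ.* + ℓ) (+ n)) (cong (_* ℕ→ℚ n) (ℤ→ℚ-homo-* (+ 2) (+ ℓ)))) (sym a*L≡1) ⟩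
    (1ℚ + 1ℚ) * L * ℕ→ℚ n + a * L      ≡⟨ solve 3 (λ L n a → (con 1ℚ :+ con 1ℚ) :* L :* n :+ a :* L := L :* (n :+ n :+ a)) refl L (ℕ→ℚ n) a ⟩
    L * (ℕ→ℚ n + ℕ→ℚ n + a)            ∎
    where open ≡-Reasoning

  module _ (n k s : ℕ) (1≤n : 1 ≤ n) (s≤n : s ≤ n) where

    private
      pa ia i1 : ℤ → ℚ
      pa j = poch a j
      ia j = inv (poch a j)
      i1 j = inv (poch 1ℚ j)

      N K S : ℚ
      N = ℕ→ℚ n
      K = ℕ→ℚ k
      S = ℕ→ℚ s

      σ P₊ P₋ P₀ A Q₊ Q₋ Q₀ I R₊ R₋ W : ℚ
      σ  = negOnePow (+ k ℤ.- + 1)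
      P₊ = pa (+ n ℤ.+ + s)
      P₋ = pa (+ n ℤ.- + s)
      P₀ = pa (+ n)
      A  = pa (+ n ℤ.+ + k ℤ.- + 1)
      Q₊ = i1 (+ n ℤ.+ + s)
      Q₋ = i1 (+ n ℤ.- + s)
      Q₀ = i1 (+ n)
      I  = i1 (+ n ℤ.- (+ k ℤ.- + 1))
      R₊ = ia (+ k ℤ.+ + s)
      R₋ = ia (+ k ℤ.- + s)
      W  = σ * (P₊ * P₋ * P₀ * A * (Q₊ * Q₋ * Q₀ * I * R₊ * R₋))

    A-suc : pa (+ n ℤ.+ + k) ≡ A * (a + (N + K - 1ℚ))
    A-suc = begin
      pa (+ n ℤ.+ + k)
        ≡⟨ cong pa (ℤ-solve 2 (λ n k → n ⊕ k ≐ n ⊕ k ⊝ ℤ-con (+ 1) ⊕ ℤ-con (+ 1)) refl (+ n) (+ k)) ⟩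
      pa (+ n ℤ.+ + k ℤ.- + 1 ℤ.+ + 1)
        ≡⟨ poch-suc a (n ℕ.+ k ∸ 1) ([+m]-[+n]≡+[m∸n] (ℕP.≤-trans 1≤n (ℕP.m≤m+n n k))) ⟩
      A * (a + ℤ→ℚ (+ n ℤ.+ + k ℤ.- + 1))
        ≡⟨ cong (λ x → A * (a + x)) (trans (ℤ→ℚ-homo-sub (+ n ℤ.+ + k) (+ 1)) (cong (_- 1ℚ) (ℕ→ℚ-homo-+ n k))) ⟩
      A * (a + (N + K - 1ℚ)) ∎
      where open ≡-Reasoning

    I-pred : i1 (+ n ℤ.- + k) ≡ (1ℚ + (N - K)) * I
    I-pred = begin
      i1 (+ n ℤ.- + k)
        ≡⟨ cong i1 (ℤ-solve 2 (λ n k → n ⊝ k ≐ n ⊝ (k ⊝ ℤ-con (+ 1)) ⊝ ℤ-con (+ 1)) refl (+ n) (+ k)) ⟩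
      i1 (+ n ℤ.- (+ k ℤ.- + 1) ℤ.- + 1)
        ≡⟨ inv-factorial-pred (+ n ℤ.- (+ k ℤ.- + 1)) ⟩
      ℤ→ℚ (+ n ℤ.- (+ k ℤ.- + 1)) * I
        ≡⟨ cong (_* I) (trans (ℤ→ℚ-homo-sub (+ n) (+ k ℤ.- + 1)) (cong (λ x → N - x) (ℤ→ℚ-homo-sub (+ k) (+ 1)))) ⟩
      (N - (K - 1ℚ)) * I
        ≡⟨ cong (_* I) (solve 2 (λ N K → N :- (K :- con 1ℚ) := con 1ℚ :+ (N :- K)) refl N K) ⟩
      (1ℚ + (N - K)) * I ∎
      where open ≡-Reasoning

    R₊-pred : ia ((+ k ℤ.- + 1) ℤ.+ + s) ≡ (a + (K + S - 1ℚ)) * R₊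
    R₊-pred =
      trans (cong ia (ℤ-solve 2 (λ k s → k ⊝ ℤ-con (+ 1) ⊕ s ≐ k ⊕ s ⊝ ℤ-con (+ 1)) refl (+ k) (+ s)))
        (trans (inv-poch-pred a a+t≢0 (+ k ℤ.+ + s))
          (cong (λ x → (a + x) * R₊) (trans (ℤ→ℚ-homo-sub (+ k ℤ.+ + s) (+ 1)) (cong (_- 1ℚ) (ℕ→ℚ-homo-+ k s)))))

    R₋-pred : ia ((+ k ℤ.- + 1) ℤ.- + s) ≡ (a + (K - S - 1ℚ)) * R₋
    R₋-pred =
      trans (cong ia (ℤ-solve 2 (λ k s → k ⊝ ℤ-con (+ 1) ⊝ s ≐ k ⊝ s ⊝ ℤ-con (+ 1)) refl (+ k) (+ s)))
        (trans (inv-poch-pred a a+t≢0 (+ k ℤ.- + s))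
          (cong (λ x → (a + x) * R₋) (trans (ℤ→ℚ-homo-sub (+ k ℤ.- + s) (+ 1)) (cong (_- 1ℚ) (ℤ→ℚ-homo-sub (+ k) (+ s))))))

    P₊-suc : pa (+ n ℤ.+ + 1 ℤ.+ + s) ≡ P₊ * (a + (N + S))
    P₊-suc =
      trans (cong pa (ℤ-solve 2 (λ n s → n ⊕ ℤ-con (+ 1) ⊕ s ≐ n ⊕ s ⊕ ℤ-con (+ 1)) refl (+ n) (+ s)))
        (trans (poch-suc a (n ℕ.+ s) refl) (cong (λ x → P₊ * (a + x)) (ℕ→ℚ-homo-+ n s)))

    P₋-suc : pa (+ n ℤ.+ + 1 ℤ.- + s) ≡ P₋ * (a + (N - S))
    P₋-suc =
      trans (cong pa (ℤ-solve 2 (λ n s → n ⊕ ℤ-con (+ 1) ⊝ s ≐ n ⊝ s ⊕ ℤ-con (+ 1)) refl (+ n) (+ s)))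
        (trans (poch-suc a (n ∸ s) ([+m]-[+n]≡+[m∸n] s≤n)) (cong (λ x → P₋ * (a + x)) (ℤ→ℚ-homo-sub (+ n) (+ s))))

    Q₊-pred : i1 (+ n ℤ.+ + s ℤ.- + 1) ≡ (N + S) * Q₊
    Q₊-pred = trans (inv-factorial-pred (+ n ℤ.+ + s)) (cong (_* Q₊) (ℕ→ℚ-homo-+ n s))

    Q₋-pred : i1 (+ n ℤ.- + s ℤ.- + 1) ≡ (N - S) * Q₋
    Q₋-pred = trans (inv-factorial-pred (+ n ℤ.- + s)) (cong (_* Q₋) (ℤ→ℚ-homo-sub (+ n) (+ s)))

    private
      E : ℚ
      E = L * (N + N + a)

    F[n,k-1]≡ : F ℓ s (+ n) (+ k ℤ.- + 1) ≡ W * (E * ((a + (K + S - 1ℚ)) * (a + (K - S - 1ℚ))))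
    F[n,k-1]≡ = begin
      F ℓ s (+ n) (+ k ℤ.- + 1)
        ≡⟨ term-cong (refl {x = σ}) (2ℓn+1≡ℓ[2n+a] n) (refl {x = P₊}) (refl {x = P₋}) (refl {x = P₀}) (cong pa (sym (ℤP.+-assoc (+ n) (+ k) (ℤ.- + 1))))
                     (refl {x = Q₊}) (refl {x = Q₋}) (refl {x = Q₀}) (refl {x = I}) R₊-pred R₋-pred ⟩
      term σ E P₊ P₋ P₀ A Q₊ Q₋ Q₀ I ((a + (K + S - 1ℚ)) * R₊) ((a + (K - S - 1ℚ)) * R₋)
        ≡⟨ solve 14 (λ σ E P₊ P₋ P₀ A Q₊ Q₋ Q₀ I R₊ R₋ x y →
             σ :* (E :* (P₊ :* P₋ :* P₀ :* A :* (Q₊ :* Q₋ :* Q₀ :* I :* (x :* R₊) :* (y :* R₋))))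
             := σ :* (P₊ :* P₋ :* P₀ :* A :* (Q₊ :* Q₋ :* Q₀ :* I :* R₊ :* R₋)) :* (E :* (x :* y)))
             refl σ E P₊ P₋ P₀ A Q₊ Q₋ Q₀ I R₊ R₋ (a + (K + S - 1ℚ)) (a + (K - S - 1ℚ)) ⟩
      W * (E * ((a + (K + S - 1ℚ)) * (a + (K - S - 1ℚ)))) ∎
      where open ≡-Reasoning

    F[n,k]≡ : F ℓ s (+ n) (+ k) ≡ - W * (E * ((a + (N + K - 1ℚ)) * (1ℚ + (N - K))))
    F[n,k]≡ = begin
      F ℓ s (+ n) (+ k)
        ≡⟨ term-cong (negOnePow-pred (+ k)) (2ℓn+1≡ℓ[2n+a] n) (refl {x = P₊}) (refl {x = P₋}) (refl {x = P₀}) A-suc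
                     (refl {x = Q₊}) (refl {x = Q₋}) (refl {x = Q₀}) I-pred (refl {x = R₊}) (refl {x = R₋}) ⟩
      term (- σ) E P₊ P₋ P₀ (A * (a + (N + K - 1ℚ))) Q₊ Q₋ Q₀ ((1ℚ + (N - K)) * I) R₊ R₋
        ≡⟨ solve 14 (λ σ E P₊ P₋ P₀ A Q₊ Q₋ Q₀ I R₊ R₋ x y →
             (:- σ) :* (E :* (P₊ :* P₋ :* P₀ :* (A :* x) :* (Q₊ :* Q₋ :* Q₀ :* (y :* I) :* R₊ :* R₋)))
             := :- (σ :* (P₊ :* P₋ :* P₀ :* A :* (Q₊ :* Q₋ :* Q₀ :* I :* R₊ :* R₋))) :* (E :* (x :* y)))
             refl σ E P₊ P₋ P₀ A Q₊ Q₋ Q₀ I R₊ R₋ (a + (N + K - 1ℚ)) (1ℚ + (N - K)) ⟩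
      - W * (E * ((a + (N + K - 1ℚ)) * (1ℚ + (N - K)))) ∎
      where open ≡-Reasoning

    G[n+1,k]≡ : G ℓ s (+ n ℤ.+ + 1) (+ k) ≡ W * (L * L * ((a + (N + S)) * (a + (N - S)) * (a + N) * (a + (N + K - 1ℚ))))
    G[n+1,k]≡ = begin
      G ℓ s (+ n ℤ.+ + 1) (+ k)
        ≡⟨ term-cong (refl {x = σ}) (ℕ→ℚ-homo-* ℓ ℓ) P₊-suc P₋-suc (poch-suc a n refl)
          (trans (cong pa (ℤ-solve 2 (λ n k → n ⊕ ℤ-con (+ 1) ⊕ k ⊝ ℤ-con (+ 1) ≐ n ⊕ k) refl (+ n) (+ k))) A-suc)
          (cong i1 (ℤ-solve 2 (λ n s → n ⊕ ℤ-con (+ 1) ⊕ s ⊝ ℤ-con (+ 1) ≐ n ⊕ s) refl (+ n) (+ s)))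
          (cong i1 (ℤ-solve 2 (λ n s → n ⊕ ℤ-con (+ 1) ⊝ s ⊝ ℤ-con (+ 1) ≐ n ⊝ s) refl (+ n) (+ s)))
          (cong i1 (ℤ-solve 1 (λ n → n ⊕ ℤ-con (+ 1) ⊝ ℤ-con (+ 1) ≐ n) refl (+ n)))
          (cong i1 (ℤ-solve 2 (λ n k → n ⊕ ℤ-con (+ 1) ⊝ k ≐ n ⊝ (k ⊝ ℤ-con (+ 1))) refl (+ n) (+ k)))
          (refl {x = R₊}) (refl {x = R₋}) ⟩
      term σ (L * L) (P₊ * (a + (N + S))) (P₋ * (a + (N - S))) (P₀ * (a + N)) (A * (a + (N + K - 1ℚ))) Q₊ Q₋ Q₀ I R₊ R₋
        ≡⟨ solve 16 (λ σ E P₊ P₋ P₀ A Q₊ Q₋ Q₀ I R₊ R₋ x y z w →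
             σ :* (E :* (P₊ :* x :* (P₋ :* y) :* (P₀ :* z) :* (A :* w) :* (Q₊ :* Q₋ :* Q₀ :* I :* R₊ :* R₋)))
             := σ :* (P₊ :* P₋ :* P₀ :* A :* (Q₊ :* Q₋ :* Q₀ :* I :* R₊ :* R₋)) :* (E :* (x :* y :* z :* w)))
             refl σ (L * L) P₊ P₋ P₀ A Q₊ Q₋ Q₀ I R₊ R₋ (a + (N + S)) (a + (N - S)) (a + N) (a + (N + K - 1ℚ)) ⟩
      W * (L * L * ((a + (N + S)) * (a + (N - S)) * (a + N) * (a + (N + K - 1ℚ)))) ∎
      where open ≡-Reasoning

    G[n,k]≡ : G ℓ s (+ n) (+ k) ≡ W * (L * L * ((N + S) * (N - S) * N * (1ℚ + (N - K))))
    G[n,k]≡ = begin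
      G ℓ s (+ n) (+ k)
        ≡⟨ term-cong (refl {x = σ}) (ℕ→ℚ-homo-* ℓ ℓ) (refl {x = P₊}) (refl {x = P₋}) (refl {x = P₀}) (refl {x = A})
                     Q₊-pred Q₋-pred (inv-factorial-pred (+ n)) I-pred (refl {x = R₊}) (refl {x = R₋}) ⟩
      term σ (L * L) P₊ P₋ P₀ A ((N + S) * Q₊) ((N - S) * Q₋) (N * Q₀) ((1ℚ + (N - K)) * I) R₊ R₋
        ≡⟨ solve 16 (λ σ E P₊ P₋ P₀ A Q₊ Q₋ Q₀ I R₊ R₋ x y z w →
             σ :* (E :* (P₊ :* P₋ :* P₀ :* A :* (x :* Q₊ :* (y :* Q₋) :* (z :* Q₀) :* (w :* I) :* R₊ :* R₋)))
             := σ :* (P₊ :* P₋ :* P₀ :* A :* (Q₊ :* Q₋ :* Q₀ :* I :* R₊ :* R₋)) :* (E :* (x :* y :* z :* w)))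
             refl σ (L * L) P₊ P₋ P₀ A Q₊ Q₋ Q₀ I R₊ R₋ (N + S) (N - S) N (1ℚ + (N - K)) ⟩
      W * (L * L * ((N + S) * (N - S) * N * (1ℚ + (N - K)))) ∎
      where open ≡-Reasoning

    recurrence :
      ℤ→ℚ (+ ℓ ℤ.* + k ℤ.- + ℓ ℤ.+ + 1) * F ℓ s (+ n) (+ k ℤ.- + 1)
        - ℤ→ℚ (+ ℓ ℤ.* + k ℤ.- + ℓ ℤ.+ + 2) * F ℓ s (+ n) (+ k)
        ≡ G ℓ s (+ n ℤ.+ + 1) (+ k) - G ℓ s (+ n) (+ k)
    recurrence =
      trans (cong₂ _-_ (cong₂ _*_ (ℓk-ℓ+1≡ℓ[k-1+a] k) F[n,k-1]≡) (cong₂ _*_ (ℓk-ℓ+2≡ℓ[k-1+2a] k) F[n,k]≡))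
        (trans (reduced-recurrence L a N K S W) (sym (cong₂ _-_ G[n+1,k]≡ G[n,k]≡)))

  -- The rising recurrence behind A-suc fails at index -1 when ℓ = 1, since then
  -- (a)_{-1} = 1/(a - 1) is the junk value 0; so n = 0 is computed directly.
  module _ where
    private
      b : ℚ
      b = rising (a - 1ℚ) 1

      b≡a-1 : b ≡ a - 1ℚ
      b≡a-1 = solve 1 (λ a → con 1ℚ :* (a :- con 1ℚ :+ con 0ℚ) := a :- con 1ℚ) refl a

    F[0,-1]≡ : F ℓ 0 (+ 0) (+ 0 ℤ.- + 1) ≡ - (L * a * (a - 1ℚ))
    F[0,-1]≡ = begin
      F ℓ 0 (+ 0) (+ 0 ℤ.- + 1)
        ≡⟨ cong₂ (λ c x → - 1ℚ * (c * (1ℚ * 1ℚ * 1ℚ * inv b * (1ℚ * 1ℚ * 1ℚ * 1ℚ * x * x))))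
                 (2ℓn+1≡ℓ[2n+a] 0) (inv-involutive b) ⟩
      - 1ℚ * (L * (0ℚ + 0ℚ + a) * (1ℚ * 1ℚ * 1ℚ * inv b * (1ℚ * 1ℚ * 1ℚ * 1ℚ * b * b)))
        ≡⟨ solve 4 (λ L a u v →
             con (- 1ℚ) :* (L :* (con 0ℚ :+ con 0ℚ :+ a) :* (con 1ℚ :* con 1ℚ :* con 1ℚ :* u
               :* (con 1ℚ :* con 1ℚ :* con 1ℚ :* con 1ℚ :* v :* v)))
             := :- (L :* a :* (u :* v :* v))) refl L a (inv b) b ⟩
      - (L * a * (inv b * b * b))
        ≡⟨ cong (λ x → - (L * a * x)) (trans (inv[x]*x*x≡x b) b≡a-1) ⟩
      - (L * a * (a - 1ℚ)) ∎
      where open ≡-Reasoning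

    F[0,0]≡ : F ℓ 0 (+ 0) (+ 0) ≡ L * a
    F[0,0]≡ = trans
      (cong (λ c → 1ℚ * (c * (1ℚ * 1ℚ * 1ℚ * 1ℚ * (1ℚ * 1ℚ * 1ℚ * 1ℚ * 1ℚ * 1ℚ)))) (2ℓn+1≡ℓ[2n+a] 0))
      (solve 2 (λ L a →
         con 1ℚ :* (L :* (con 0ℚ :+ con 0ℚ :+ a) :* (con 1ℚ :* con 1ℚ :* con 1ℚ :* con 1ℚ
           :* (con 1ℚ :* con 1ℚ :* con 1ℚ :* con 1ℚ :* con 1ℚ :* con 1ℚ)))
             := L :* a) refl L a)

    G[1,0]≡ : G ℓ 0 (+ 0 ℤ.+ + 1) (+ 0) ≡ - (L * L * (a * a * a))
    G[1,0]≡ = trans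
      (cong (λ c → - 1ℚ * (c * (1ℚ * (a + 0ℚ) * (1ℚ * (a + 0ℚ)) * (1ℚ * (a + 0ℚ)) * 1ℚ
                     * (1ℚ * 1ℚ * 1ℚ * 1ℚ * 1ℚ * 1ℚ))))
            (ℕ→ℚ-homo-* ℓ ℓ))
      (solve 2 (λ L a →
         con (- 1ℚ) :* (L :* L :* (con 1ℚ :* (a :+ con 0ℚ) :* (con 1ℚ :* (a :+ con 0ℚ)) :* (con 1ℚ :* (a :+ con 0ℚ))
           :* con 1ℚ :* (con 1ℚ :* con 1ℚ :* con 1ℚ :* con 1ℚ :* con 1ℚ :* con 1ℚ)))
             := :- (L :* L :* (a :* a :* a))) refl L a)

    G[0,0]≡0 : G ℓ 0 (+ 0) (+ 0) ≡ 0ℚ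
    G[0,0]≡0 = solve 2 (λ c u →
      con (- 1ℚ) :* (c :* (con 1ℚ :* con 1ℚ :* con 1ℚ :* u
        :* (con 0ℚ :* con 0ℚ :* con 0ℚ :* con 1ℚ :* con 1ℚ :* con 1ℚ)))
      := con 0ℚ) refl (ℕ→ℚ (ℓ ℕ.* ℓ)) (inv b)

    recurrence-at-0 :
      ℤ→ℚ (+ ℓ ℤ.* + 0 ℤ.- + ℓ ℤ.+ + 1) * F ℓ 0 (+ 0) (+ 0 ℤ.- + 1)
        - ℤ→ℚ (+ ℓ ℤ.* + 0 ℤ.- + ℓ ℤ.+ + 2) * F ℓ 0 (+ 0) (+ 0)
        ≡ G ℓ 0 (+ 0 ℤ.+ + 1) (+ 0) - G ℓ 0 (+ 0) (+ 0)
    recurrence-at-0 =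
      trans (cong₂ _-_ (cong₂ _*_ (ℓk-ℓ+1≡ℓ[k-1+a] 0) F[0,-1]≡) (cong₂ _*_ (ℓk-ℓ+2≡ℓ[k-1+2a] 0) F[0,0]≡))
        (trans (solve 2 (λ L a →
                  L :* (con 0ℚ :- con 1ℚ :+ a) :* (:- (L :* a :* (a :- con 1ℚ)))
                    :- L :* (con 0ℚ :- con 1ℚ :+ a :+ a) :* (L :* a)
                  := :- (L :* L :* (a :* a :* a)) :- con 0ℚ) refl L a)
          (sym (cong₂ _-_ G[1,0]≡ G[0,0]≡0)))

lemma3p1 : (ℓ n s k : ℕ) → 1 ≤ ℓ → s ≤ n → k ≤ n →
    ℤ→ℚ (+ ℓ ℤ.* + k ℤ.- + ℓ ℤ.+ + 1) * F ℓ s (+ n) (+ k ℤ.- + 1)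
    - ℤ→ℚ (+ ℓ ℤ.* + k ℤ.- + ℓ ℤ.+ + 2) * F ℓ s (+ n) (+ k)
    ≡ G ℓ s (+ n ℤ.+ + 1) (+ k) - G ℓ s (+ n) (+ k)
-- k ≤ n is needed only to force k = 0 when n = 0; for n ≥ 1 the factor 1/(1)_{n-k}
-- vanishes consistently when k > n.
lemma3p1 (suc l) zero    zero zero _ z≤n z≤n = WZPair.recurrence-at-0 l
lemma3p1 (suc l) (suc m) s    k    _ s≤n _   = WZPair.recurrence l (suc m) k s (s≤s z≤n) s≤n
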